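{- Let $(Q,\ast)$ be a finite quasigroup and $a\in Q$. For subsets $X,Y\subseteq Q$ write $XY=\{x\ast y\mid x\in X,y\in Y\}$. Define $A_0=\{a\}$ and $A_{j+1}=A_jA_j\cup A_j$ for $j\geq0$, and let $k$ be an index with $A_{k+1}=A_k$. If $|A_k|>|Q|/2$, then $A_k=Q$.
   Context: A quasigroup is a set $Q$ with a binary operation $\ast$ such that for all $a,b\in Q$ the equations $a\ast x=b$ and $y\ast a=b$ have unique solutions in $Q$. -}

module Defs where

open import Data.Nat using (ℕ; zero; suc)
open import Data.Fin using (Fin; _≟_)
open import Data.Fin.Properties using (any?)
open import Data.Fin.Subset using (Subset; _∈_; _∪_; ⁅_⁆)
open import Data.Fin.Subset.Properties using (_∈?_)
open import Data.Vec using (tabulate)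
open import Data.Product using (∃; _×_; _,_)
open import Data.Bool using (true; false)
open import Relation.Nullary using (Dec; yes; no)
open import Relation.Nullary.Decidable using (_×-dec_; ⌊_⌋)
open import Relation.Binary.PropositionalEquality using (_≡_)

-- A finite quasigroup on the carrier Fin n (every finite set is in bijection
-- with some Fin n): for all a b, the equations a * x = b and y * a = b have
-- unique solutions.
UniqueSol : ∀ {n} → (Fin n → Set) → Set
UniqueSol {n} P = ∃ λ x → P x × (∀ x' → P x' → x' ≡ x)

IsQuasigroup : ∀ {n} → (Fin n → Fin n → Fin n) → Set
IsQuasigroup {n} _*_ =
  (a b : Fin n) → UniqueSol (λ x → a * x ≡ b) × UniqueSol (λ y → y * a ≡ b)

prodSet : ∀ {n} → (Fin n → Fin n → Fin n) → Subset n → Subset n → Subset n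
prodSet {n} _*_ X Y = tabulate λ z →
  ⌊ any? (λ x → any? (λ y → (x ∈? X) ×-dec ((y ∈? Y) ×-dec (x * y ≟ z)))) ⌋

A : ∀ {n} → (Fin n → Fin n → Fin n) → Fin n → ℕ → Subset n
A _*_ a zero = ⁅ a ⁆
A _*_ a (suc j) = prodSet _*_ (A _*_ a j) (A _*_ a j) ∪ A _*_ a j

-- Once A k = A (k+1), the set S = A k is closed under ∗.  If some z lay outside S,
-- the right quotients z / s (the y with y ∗ s = z) for s ∈ S would be |S| distinct
-- elements, none in S since S is closed; so |S| ≤ |Q| − |S|.
module Submission where

open import Defs
open import Data.Nat using (ℕ; suc; _*_; _>_; _≤_; _+_; _∸_; z≤n; s≤s)
open import Data.Nat.Properties using (+-identityʳ; m≤o∸n⇒m+n≤o; ≤⇒≯; module ≤-Reasoning)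
open import Data.Fin using (Fin)
open import Data.Fin.Subset
  using (Subset; _∈_; _∉_; _⊂_; _─_; _-_; ∁; ⊤; inside; outside; ∣_∣)
open import Data.Fin.Subset.Properties
  using ( _∈?_; nonempty?; Empty-unique; ∣⊥∣≡0; ∣p∣≤n; ∣∁p∣≡n∸∣p∣; p─⊥≡p
        ; x∈⁅x⁆; x∈p∪q⁺; x∉p⇒x∈∁p; x∈p∧x≢y⇒x∈p-y; p─q⊆p; x∈p⇒p-x⊂p
        ; x∈p⇒∣p-x∣<∣p∣; ⊆-antisym; ⊆-max)
open import Data.Fin.Subset.Induction using (Acc; acc; ⊂-wellFounded)
open import Data.Vec using (_∷_; here; there)
open import Data.Vec.Properties using (lookup∘tabulate; lookup⇒[]=)
open import Data.Product using (_,_; proj₁; proj₂)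
open import Data.Sum using (inj₁)
open import Data.Bool.Properties using (T-≡)
open import Function.Bundles using (Equivalence)
open import Function.Definitions using (Injective)
open import Relation.Nullary using (yes; no; contradiction)
open import Relation.Nullary.Decidable using (fromWitness)
open import Relation.Binary.PropositionalEquality
  using (_≡_; _≢_; refl; sym; trans; cong; subst; module ≡-Reasoning)

private
  variable
    n : ℕ

∣p∣≡1+∣p-x∣ : {p : Subset n} {x : Fin n} → x ∈ p → ∣ p ∣ ≡ suc ∣ p - x ∣
∣p∣≡1+∣p-x∣ {p = inside  ∷ p} here        = cong (λ q → suc ∣ q ∣) (sym (p─⊥≡p p))
∣p∣≡1+∣p-x∣ {p = inside  ∷ p} (there x∈p) = cong suc (∣p∣≡1+∣p-x∣ x∈p)
∣p∣≡1+∣p-x∣ {p = outside ∷ p} (there x∈p) = ∣p∣≡1+∣p-x∣ x∈p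

x∈p─q⇒x∉q : {p q : Subset n} {x : Fin n} → x ∈ p ─ q → x ∉ q
x∈p─q⇒x∉q {p = _ ∷ _} {outside ∷ _} here        ()
x∈p─q⇒x∉q {p = _ ∷ _} {_       ∷ _} (there x∈)  (there x∈q) = x∈p─q⇒x∉q x∈ x∈q

x∈p-y⇒x≢y : {p : Subset n} {x y : Fin n} → x ∈ p - y → x ≢ y
x∈p-y⇒x≢y x∈p-y refl = x∈p─q⇒x∉q x∈p-y (x∈⁅x⁆ _)

module _ {h : Fin n → Fin n} (h-injective : Injective _≡_ _≡_ h) where

  injective⇒∣p∣≤∣q∣ : (p q : Subset n) → (∀ {x} → x ∈ p → h x ∈ q) → ∣ p ∣ ≤ ∣ q ∣
  injective⇒∣p∣≤∣q∣ p = go p (⊂-wellFounded p)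
    where
    go : ∀ p → Acc _⊂_ p → ∀ q → (∀ {x} → x ∈ p → h x ∈ q) → ∣ p ∣ ≤ ∣ q ∣
    go p (acc rec) q h[p]⊆q with nonempty? p
    ... | no p-empty rewrite Empty-unique p-empty | ∣⊥∣≡0 n = z≤n
    ... | yes (x , x∈p) = begin
      ∣ p ∣           ≡⟨ ∣p∣≡1+∣p-x∣ x∈p ⟩
      suc ∣ p - x ∣   ≤⟨ s≤s (go (p - x) (rec (x∈p⇒p-x⊂p x∈p)) (q - h x) h[p-x]⊆q-hx) ⟩
      suc ∣ q - h x ∣ ≤⟨ x∈p⇒∣p-x∣<∣p∣ (h[p]⊆q x∈p) ⟩
      ∣ q ∣           ∎
      where
      open ≤-Reasoning
      h[p-x]⊆q-hx : ∀ {y} → y ∈ p - x → h y ∈ q - h x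
      h[p-x]⊆q-hx y∈ = x∈p∧x≢y⇒x∈p-y (h[p]⊆q (p─q⊆p _ _ y∈))
                                       (λ hy≡hx → x∈p-y⇒x≢y y∈ (h-injective hy≡hx))

∈-prodSet : (_∙_ : Fin n → Fin n → Fin n) {X Y : Subset n} {x y : Fin n} →
            x ∈ X → y ∈ Y → x ∙ y ∈ prodSet _∙_ X Y
∈-prodSet _∙_ {X} {Y} {x} {y} x∈X y∈Y = lookup⇒[]= (x ∙ y) (prodSet _∙_ X Y)
  (trans (lookup∘tabulate _ (x ∙ y))
         (Equivalence.to T-≡ (fromWitness (x , y , x∈X , y∈Y , refl))))

Closed : (Fin n → Fin n → Fin n) → Subset n → Set
Closed _∙_ S = ∀ {x y} → x ∈ S → y ∈ S → x ∙ y ∈ S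

A-closed : (_∙_ : Fin n → Fin n → Fin n) (a : Fin n) (k : ℕ) →
           A _∙_ a (suc k) ≡ A _∙_ a k → Closed _∙_ (A _∙_ a k)
A-closed _∙_ a k A-stable x∈ y∈ =
  subst (_ ∈_) A-stable (x∈p∪q⁺ (inj₁ (∈-prodSet _∙_ x∈ y∈)))

module Quasigroup {_∙_ : Fin n → Fin n → Fin n} (quasigroup : IsQuasigroup _∙_) where

  _/_ : Fin n → Fin n → Fin n
  z / s = proj₁ (proj₂ (quasigroup s z))

  /-∙-cancel : ∀ z s → (z / s) ∙ s ≡ z
  /-∙-cancel z s = proj₁ (proj₂ (proj₂ (quasigroup s z)))

  ∙-cancelˡ : ∀ x {s t} → x ∙ s ≡ x ∙ t → s ≡ t
  ∙-cancelˡ x {s} {t} xs≡xt =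
    let (_ , _ , unique) = proj₁ (quasigroup x (x ∙ t))
    in  trans (unique s xs≡xt) (sym (unique t refl))

  /-injective : ∀ z → Injective _≡_ _≡_ (z /_)
  /-injective z {s} {t} z/s≡z/t = ∙-cancelˡ (z / s) (begin
    (z / s) ∙ s  ≡⟨ /-∙-cancel z s ⟩
    z            ≡⟨ /-∙-cancel z t ⟨
    (z / t) ∙ t  ≡⟨ cong (_∙ t) z/s≡z/t ⟨
    (z / s) ∙ t  ∎)
    where open ≡-Reasoning

  closed-∉⇒∣S∣≤∣∁S∣ : {S : Subset n} {z : Fin n} → Closed _∙_ S → z ∉ S → ∣ S ∣ ≤ ∣ ∁ S ∣
  closed-∉⇒∣S∣≤∣∁S∣ {S} {z} closed z∉S = injective⇒∣p∣≤∣q∣ (/-injective z) S (∁ S)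
    λ {s} s∈S → x∉p⇒x∈∁p λ z/s∈S → z∉S (subst (_∈ S) (/-∙-cancel z s) (closed z/s∈S s∈S))

  closed-large⇒⊤ : {S : Subset n} → Closed _∙_ S → 2 * ∣ S ∣ > n → S ≡ ⊤
  closed-large⇒⊤ {S} closed large = ⊆-antisym (⊆-max S) S-full
    where
    S-full : ∀ {z} → z ∈ ⊤ → z ∈ S
    S-full {z} _ with z ∈? S
    ... | yes z∈S = z∈S
    ... | no  z∉S = contradiction large (≤⇒≯ (begin
      2 * ∣ S ∣          ≡⟨ cong (∣ S ∣ +_) (+-identityʳ ∣ S ∣) ⟩
      (∣ S ∣) + (∣ S ∣)  ≤⟨ m≤o∸n⇒m+n≤o ∣ S ∣ (∣p∣≤n S) ∣S∣≤n∸∣S∣ ⟩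
      n                  ∎))
      where
      open ≤-Reasoning
      ∣S∣≤n∸∣S∣ : ∣ S ∣ ≤ n ∸ ∣ S ∣
      ∣S∣≤n∸∣S∣ = subst (∣ S ∣ ≤_) (∣∁p∣≡n∸∣p∣ S) (closed-∉⇒∣S∣≤∣∁S∣ closed z∉S)

proposition6 : (n : ℕ) (op : Fin n → Fin n → Fin n) → IsQuasigroup op →
    (a : Fin n) (k : ℕ) → A op a (suc k) ≡ A op a k →
    2 * ∣ A op a k ∣ > n → A op a k ≡ ⊤
proposition6 n op quasigroup a k A-stable =
  Quasigroup.closed-large⇒⊤ quasigroup (A-closed op a k A-stable)
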